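{- Let $n\ge1$, let $L_1,\dots,L_k$ be positive integers with $\sum_{j=1}^k L_j\le n$, and let $V_1,\dots,V_k$ be independent random vectors in $\mathbb{Z}^2$, where each $V_j$ has either the trivial-to-non-trivial distribution of block length $L_j$, or (only if $L_j\ge2$) a non-trivial-to-non-trivial distribution of block length $L_j$. Let $R=\sum_{j=1}^k V_j$. Then $\Pr\left(\|R-\mathbb{E}[R]\|_2\le\sqrt{2n}\right)\ge\frac12$, i.e. at least half of the distribution of $R$ lies in the closed disc of radius $\sqrt{2n}$ centered at its mean.
   Context: The trivial-to-non-trivial distribution of block length $L$ is the law of $(X,X)$ where $X$ is binomial with $L$ trials and success probability $\frac12$. A non-trivial-to-non-trivial distribution of block length $L$ is either the law of $(X,Y)$ with $\Pr[(X,Y)=(x,y)]=\frac{1}{2^L-1}\binom{L-y+x-2}{x-1}$ for $L-1\ge y\ge x-1\ge0$ and $0$ otherwise (equivalently, $(wt(s),wt(s-1))$ for $s$ uniform among the nonzero elements of $\{0,1\}^L$, viewed as integers mod $2^L$, $wt$ = Hamming weight), or the law of $(Y,X)$ obtained by swapping the two coordinates. -}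

module Defs where

open import Data.Nat as ℕ using (ℕ; zero; suc; _∸_; _^_; _≤_; _<_; _≤ᵇ_; z≤n; s≤s)
open import Data.Nat.Properties using (m≤m+n; <-≤-trans; m<n⇒0<n∸m; m^n>0)
open import Data.Nat.Combinatorics using (_C_)
open import Data.Integer as ℤ using (ℤ; +_)
open import Data.Rational as ℚ using (ℚ; 0ℚ; 1ℚ)
open import Data.Bool using (Bool; if_then_else_; _∧_)
open import Data.List using (List; []; _∷_; map; concatMap; foldr; upTo)
open import Data.Product using (_×_; _,_; proj₁; proj₂)
open import Relation.Nullary.Decidable using (does)

Pt : Set
Pt = ℤ × ℤ

-- A finitely supported probability law on ℤ², given as a finite list of
-- weighted atoms (probability, point); the law is Σ p·δ_v (atoms may repeat
-- or have probability 0).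
Law : Set
Law = List (ℚ × Pt)

private
  1<2^suc : ∀ m → 1 < 2 ^ suc m
  1<2^suc zero = s≤s (s≤s z≤n)
  1<2^suc (suc m) = <-≤-trans (1<2^suc m) (m≤m+n (2 ^ suc m) (2 ^ suc m ℕ.+ 0))

2^suc∸1>0 : ∀ m → 0 < 2 ^ suc m ∸ 1
2^suc∸1>0 m = m<n⇒0<n∸m (1<2^suc m)

-- trivial-to-non-trivial distribution of block length L : law of (X,X),
-- X ~ Binomial(L, 1/2)
trivLaw : ℕ → Law
trivLaw L = map (λ x → (ℚ._/_ (+ (L C x)) (2 ^ L) {{ℕ.>-nonZero (m^n>0 2 L)}} , (+ x , + x)))
                (upTo (suc L))

-- non-trivial-to-non-trivial distribution of block length L (first version):
-- Pr[(X,Y)=(x,y)] = C(L-y+x-2, x-1)/(2^L-1) for L-1 ≥ y ≥ x-1 ≥ 0, else 0.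
-- We enumerate all (x,y) ∈ {0..L}² and give weight 0 outside the support.
ntntWeight : ℕ → ℕ → ℕ → ℕ
ntntWeight L x y =
  if (1 ≤ᵇ x) ∧ (x ∸ 1 ≤ᵇ y) ∧ (y ≤ᵇ L ∸ 1)
  then ((L ∸ y ℕ.+ x) ∸ 2) C (x ∸ 1)
  else 0

ntntLaw : ℕ → Law
ntntLaw zero = []
ntntLaw (suc m) =
  concatMap (λ x → map (λ y →
      (ℚ._/_ (+ ntntWeight (suc m) x y) (2 ^ suc m ∸ 1) {{ℕ.>-nonZero (2^suc∸1>0 m)}}
      , (+ x , + y)))
    (upTo (suc (suc m))))
  (upTo (suc (suc m)))

swapPt : Pt → Pt
swapPt (a , b) = (b , a)

ntntSwapLaw : ℕ → Law
ntntSwapLaw L = map (λ a → (proj₁ a , swapPt (proj₂ a))) (ntntLaw L)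

data Kind : Set where
  triv ntnt ntntSwap : Kind

lawOf : Kind → ℕ → Law
lawOf triv L = trivLaw L
lawOf ntnt L = ntntLaw L
lawOf ntntSwap L = ntntSwapLaw L

Admissible : ℕ × Kind → Set
Admissible (L , triv) = 1 ≤ L
Admissible (L , ntnt) = 2 ≤ L
Admissible (L , ntntSwap) = 2 ≤ L

addPt : Pt → Pt → Pt
addPt (a , b) (c , d) = (a ℤ.+ c , b ℤ.+ d)

indepSum : Law → Law → Law
indepSum μ ν = concatMap (λ a → map (λ b → (proj₁ a ℚ.* proj₁ b , addPt (proj₂ a) (proj₂ b))) ν) μ

dirac0 : Law
dirac0 = (1ℚ , (+ 0 , + 0)) ∷ []

sumLaw : List (ℕ × Kind) → Law
sumLaw bs = foldr (λ b acc → indepSum (lawOf (proj₂ b) (proj₁ b)) acc) dirac0 bs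

meanX meanY : Law → ℚ
meanX μ = foldr (λ a s → proj₁ a ℚ.* (proj₁ (proj₂ a) ℚ./ 1) ℚ.+ s) 0ℚ μ
meanY μ = foldr (λ a s → proj₁ a ℚ.* (proj₂ (proj₂ a) ℚ./ 1) ℚ.+ s) 0ℚ μ

sqDist : ℚ → ℚ → Pt → ℚ
sqDist mx my (a , b) = let dx = (a ℚ./ 1) ℚ.- mx ; dy = (b ℚ./ 1) ℚ.- my in dx ℚ.* dx ℚ.+ dy ℚ.* dy

-- Pr(‖R - E[R]‖₂ ≤ r) where r² = rsq  (i.e. ‖R-E R‖₂² ≤ rsq)
discProb : ℚ → Law → ℚ
discProb rsq μ = foldr (λ a s →
    (if does (sqDist (meanX μ) (meanY μ) (proj₂ a) ℚ.≤? rsq) then proj₁ a else 0ℚ) ℚ.+ s) 0ℚ μ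

sumL : List (ℕ × Kind) → ℕ
sumL = foldr (λ b s → proj₁ b ℕ.+ s) 0

-- By Chebyshev's inequality in ℤ², Pr(‖R − 𝔼R‖² > 2n) ≤ Var R / 2n, where Var R = 𝔼‖R − 𝔼R‖² is
-- additive over the independent blocks. So it suffices that a block of length L has variance at most L,
-- and the variance is at most the second moment about (L/2, L/2), which can be computed exactly: for
-- the trivial block from the binomial moments Σₓ C(L,x) xᵏ, and for the non-trivial block from a
-- Pascal-type recursion of the weights C(L−y+x−2, x−1) that splits the block of length L+1 into the
-- block of length L, its translate by (1,1), and one more atom.
module Submission where

open import Defs

module Casts where

  open import Data.Nat as ℕ using (ℕ; suc)
  import Data.Nat.Properties as ℕP
  open import Data.Integer as ℤ using (ℤ; +_)
  import Data.Integer.Properties as ℤP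
  open import Data.Rational as ℚ using (ℚ; 0ℚ; _/_)
  import Data.Rational.Properties as ℚP
  import Data.Rational.Unnormalised as ℚᵘ
  import Data.Rational.Unnormalised.Properties as ℚᵘP
  import Data.Rational.Solver
  open import Data.Sum using (inj₁; inj₂)
  open import Relation.Binary.PropositionalEquality

  fromℤ : ℤ → ℚ
  fromℤ a = a / 1

  fromℕ : ℕ → ℚ
  fromℕ n = fromℤ (+ n)

  private
    toℚᵘ-/ : ∀ i k → ℚ.toℚᵘ (i / suc k) ℚᵘ.≃ ℚᵘ.mkℚᵘ i k
    toℚᵘ-/ i k = ℚP.toℚᵘ-fromℚᵘ (ℚᵘ.mkℚᵘ i k)

  fromℤ-+ : ∀ a b → fromℤ (a ℤ.+ b) ≡ fromℤ a ℚ.+ fromℤ b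
  fromℤ-+ a b = ℚP.toℚᵘ-injective (ℚᵘP.≃-trans (toℚᵘ-/ (a ℤ.+ b) 0) (ℚᵘP.≃-trans (ℚᵘ.*≡* cross)
    (ℚᵘP.≃-sym (ℚᵘP.≃-trans (ℚP.toℚᵘ-homo-+ (fromℤ a) (fromℤ b)) (ℚᵘP.+-cong (toℚᵘ-/ a 0) (toℚᵘ-/ b 0))))))
    where
    cross : (a ℤ.+ b) ℤ.* + 1 ≡ (a ℤ.* + 1 ℤ.+ b ℤ.* + 1) ℤ.* + 1
    cross = cong (ℤ._* + 1) (sym (cong₂ ℤ._+_ (ℤP.*-identityʳ a) (ℤP.*-identityʳ b)))

  fromℕ-+ : ∀ m n → fromℕ (m ℕ.+ n) ≡ fromℕ m ℚ.+ fromℕ n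
  fromℕ-+ m n = trans (cong fromℤ (ℤP.pos-+ m n)) (fromℤ-+ (+ m) (+ n))

  fromℕ-* : ∀ m n → fromℕ (m ℕ.* n) ≡ fromℕ m ℚ.* fromℕ n
  fromℕ-* m n = ℚP.toℚᵘ-injective (ℚᵘP.≃-trans (toℚᵘ-/ (+ (m ℕ.* n)) 0) (ℚᵘP.≃-trans (ℚᵘ.*≡* cross)
    (ℚᵘP.≃-sym (ℚᵘP.≃-trans (ℚP.toℚᵘ-homo-* (fromℕ m) (fromℕ n)) (ℚᵘP.*-cong (toℚᵘ-/ (+ m) 0) (toℚᵘ-/ (+ n) 0))))))
    where
    cross : + (m ℕ.* n) ℤ.* + 1 ≡ (+ m ℤ.* + n) ℤ.* + 1
    cross = cong (ℤ._* + 1) (ℤP.pos-* m n)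

  fromℕ-mono-≤ : ∀ {m n} → m ℕ.≤ n → fromℕ m ℚ.≤ fromℕ n
  fromℕ-mono-≤ {m} {n} m≤n = ℚP.toℚᵘ-cancel-≤
    (ℚᵘP.≤-respˡ-≃ (ℚᵘP.≃-sym (toℚᵘ-/ (+ m) 0)) (ℚᵘP.≤-respʳ-≃ (ℚᵘP.≃-sym (toℚᵘ-/ (+ n) 0))
      (ℚᵘ.*≤* (ℤP.*-monoʳ-≤-nonNeg (+ 1) (ℤ.+≤+ m≤n)))))

  fromℕ-pos : ∀ n .{{_ : ℕ.NonZero n}} → 0ℚ ℚ.< fromℕ n
  fromℕ-pos (suc k) = ℚP.positive⁻¹ _ {{ℚP.normalize-pos (suc k) 1}}

  d*[w/d]≡w : ∀ d w .{{_ : ℕ.NonZero d}} → fromℕ d ℚ.* ((+ w) / d) ≡ fromℕ w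
  d*[w/d]≡w (suc k) w = ℚP.toℚᵘ-injective (ℚᵘP.≃-trans (ℚP.toℚᵘ-homo-* (fromℕ (suc k)) ((+ w) / suc k))
    (ℚᵘP.≃-trans (ℚᵘP.*-cong (toℚᵘ-/ (+ suc k) 0) (toℚᵘ-/ (+ w) k))
      (ℚᵘP.≃-trans (ℚᵘ.*≡* cross) (ℚᵘP.≃-sym (toℚᵘ-/ (+ w) 0)))))
    where
    cross : (+ suc k ℤ.* + w) ℤ.* + 1 ≡ + w ℤ.* (+ (1 ℕ.* suc k))
    cross rewrite ℕP.*-identityˡ (suc k) = trans (ℤP.*-identityʳ (+ suc k ℤ.* + w)) (ℤP.*-comm (+ suc k) (+ w))

  w/d-nonNeg : ∀ w d .{{_ : ℕ.NonZero d}} → 0ℚ ℚ.≤ (+ w) / d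
  w/d-nonNeg w d = ℚP.nonNegative⁻¹ _ {{ℚP.normalize-nonNeg w d}}

  *-nonNeg : ∀ {p q} → 0ℚ ℚ.≤ p → 0ℚ ℚ.≤ q → 0ℚ ℚ.≤ p ℚ.* q
  *-nonNeg {p} {q} 0≤p 0≤q =
    ℚP.nonNegative⁻¹ _ {{ℚP.nonNeg*nonNeg⇒nonNeg p {{ℚ.nonNegative 0≤p}} q {{ℚ.nonNegative 0≤q}}}}

  0≤p*p : ∀ p → 0ℚ ℚ.≤ p ℚ.* p
  0≤p*p p with ℚP.≤-total 0ℚ p
  ... | inj₁ 0≤p = *-nonNeg 0≤p 0≤p
  ... | inj₂ p≤0 = ℚP.nonNegative⁻¹ _ {{ℚP.nonPos*nonPos⇒nonPos p {{ℚ.nonPositive p≤0}} p {{ℚ.nonPositive p≤0}}}}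

  p≤q⇒0≤q-p : ∀ {p q} → p ℚ.≤ q → 0ℚ ℚ.≤ q ℚ.- p
  p≤q⇒0≤q-p {p} {q} p≤q = subst (ℚ._≤ q ℚ.- p) (ℚP.+-inverseʳ p) (ℚP.+-monoˡ-≤ (ℚ.- p) p≤q)

  0≤q-p⇒p≤q : ∀ {p q} → 0ℚ ℚ.≤ q ℚ.- p → p ℚ.≤ q
  0≤q-p⇒p≤q {p} {q} 0≤q-p = subst₂ ℚ._≤_ (ℚP.+-identityʳ p) p+[q-p]≡q (ℚP.+-monoʳ-≤ p 0≤q-p)
    where
    open Data.Rational.Solver.+-*-Solver
    p+[q-p]≡q : p ℚ.+ (q ℚ.- p) ≡ q
    p+[q-p]≡q = solve 2 (λ x y → x :+ (y :- x) := y) refl p q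

module Expectation where

  open Casts
  open import Data.Rational as ℚ using (ℚ; 0ℚ; 1ℚ)
  import Data.Rational.Properties as ℚP
  open import Data.Rational.Solver using (module +-*-Solver)
  open import Data.List using ([]; _∷_; map; foldr; _++_)
  open import Data.List.Relation.Unary.All using (All; []; _∷_)
  open import Data.Product using (_,_; proj₁; proj₂)
  open import Relation.Binary.PropositionalEquality
  open +-*-Solver

  𝔼 : (Pt → ℚ) → Law → ℚ
  𝔼 f = foldr (λ a s → proj₁ a ℚ.* f (proj₂ a) ℚ.+ s) 0ℚ

  mass : Law → ℚ
  mass = 𝔼 (λ _ → 1ℚ)

  X Y normSq : Pt → ℚ
  X v = fromℤ (proj₁ v)
  Y v = fromℤ (proj₂ v)
  normSq v = X v ℚ.* X v ℚ.+ Y v ℚ.* Y v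

  -- meanX μ and meanY μ of Defs are definitionally 𝔼 X μ and 𝔼 Y μ.
  variance : Law → ℚ
  variance μ = 𝔼 normSq μ ℚ.- meanX μ ℚ.* meanX μ ℚ.- meanY μ ℚ.* meanY μ

  NonNeg : Law → Set
  NonNeg = All (λ a → 0ℚ ℚ.≤ proj₁ a)

  𝔼-cong : ∀ {f g} → (∀ v → f v ≡ g v) → ∀ μ → 𝔼 f μ ≡ 𝔼 g μ
  𝔼-cong f≗g [] = refl
  𝔼-cong f≗g (a ∷ μ) = cong₂ (λ u w → proj₁ a ℚ.* u ℚ.+ w) (f≗g (proj₂ a)) (𝔼-cong f≗g μ)

  𝔼-++ : ∀ f μ ν → 𝔼 f (μ ++ ν) ≡ 𝔼 f μ ℚ.+ 𝔼 f ν
  𝔼-++ f [] ν = sym (ℚP.+-identityˡ _)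
  𝔼-++ f (a ∷ μ) ν rewrite 𝔼-++ f μ ν = sym (ℚP.+-assoc (proj₁ a ℚ.* f (proj₂ a)) (𝔼 f μ) (𝔼 f ν))

  𝔼-const : ∀ c μ → 𝔼 (λ _ → c) μ ≡ c ℚ.* mass μ
  𝔼-const c [] = sym (ℚP.*-zeroʳ c)
  𝔼-const c (a ∷ μ) rewrite 𝔼-const c μ =
    solve 3 (λ p c m → p :* c :+ c :* m := c :* (p :* con 1ℚ :+ m)) refl (proj₁ a) c (mass μ)

  𝔼-+ : ∀ f g μ → 𝔼 (λ v → f v ℚ.+ g v) μ ≡ 𝔼 f μ ℚ.+ 𝔼 g μ
  𝔼-+ f g [] = sym (ℚP.+-identityˡ 0ℚ)
  𝔼-+ f g (a ∷ μ) rewrite 𝔼-+ f g μ =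
    solve 5 (λ p x y s t → p :* (x :+ y) :+ (s :+ t) := (p :* x :+ s) :+ (p :* y :+ t)) refl
      (proj₁ a) (f (proj₂ a)) (g (proj₂ a)) (𝔼 f μ) (𝔼 g μ)

  𝔼-quadratic : ∀ a b c d μ → 𝔼 (λ v → a ℚ.* normSq v ℚ.+ b ℚ.* X v ℚ.+ c ℚ.* Y v ℚ.+ d) μ
                ≡ a ℚ.* 𝔼 normSq μ ℚ.+ b ℚ.* meanX μ ℚ.+ c ℚ.* meanY μ ℚ.+ d ℚ.* mass μ
  𝔼-quadratic a b c d [] =
    solve 4 (λ a b c d → con 0ℚ := a :* con 0ℚ :+ b :* con 0ℚ :+ c :* con 0ℚ :+ d :* con 0ℚ) refl a b c d
  𝔼-quadratic a b c d (x ∷ μ) rewrite 𝔼-quadratic a b c d μ =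
    solve 12 (λ a b c d p q u w s₁ s₂ s₃ s₄ →
       p :* (a :* q :+ b :* u :+ c :* w :+ d) :+ (a :* s₁ :+ b :* s₂ :+ c :* s₃ :+ d :* s₄)
       := a :* (p :* q :+ s₁) :+ b :* (p :* u :+ s₂) :+ c :* (p :* w :+ s₃) :+ d :* (p :* con 1ℚ :+ s₄)) refl
       a b c d (proj₁ x) (normSq (proj₂ x)) (X (proj₂ x)) (Y (proj₂ x)) (𝔼 normSq μ) (meanX μ) (meanY μ) (mass μ)

  𝔼-indepSum : ∀ f μ ν → 𝔼 f (indepSum μ ν) ≡ 𝔼 (λ u → 𝔼 (λ w → f (addPt u w)) ν) μ
  𝔼-indepSum f [] ν = refl
  𝔼-indepSum f ((p , u) ∷ μ) ν =
    trans (𝔼-++ f (map (λ b → (p ℚ.* proj₁ b , addPt u (proj₂ b))) ν) (indepSum μ ν))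
          (cong₂ ℚ._+_ (𝔼-shift ν) (𝔼-indepSum f μ ν))
    where
    𝔼-shift : ∀ ν → 𝔼 f (map (λ b → (p ℚ.* proj₁ b , addPt u (proj₂ b))) ν) ≡ p ℚ.* 𝔼 (λ w → f (addPt u w)) ν
    𝔼-shift [] = sym (ℚP.*-zeroʳ p)
    𝔼-shift (b ∷ ν) rewrite 𝔼-shift ν =
      solve 4 (λ p q x s → p :* q :* x :+ p :* s := p :* (q :* x :+ s)) refl
        p (proj₁ b) (f (addPt u (proj₂ b))) (𝔼 (λ w → f (addPt u w)) ν)

  ++-nonNeg : ∀ {μ ν} → NonNeg μ → NonNeg ν → NonNeg (μ ++ ν)
  ++-nonNeg [] ν⁺ = ν⁺
  ++-nonNeg (p⁺ ∷ μ⁺) ν⁺ = p⁺ ∷ ++-nonNeg μ⁺ ν⁺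

  indepSum-nonNeg : ∀ {μ ν} → NonNeg μ → NonNeg ν → NonNeg (indepSum μ ν)
  indepSum-nonNeg [] ν⁺ = []
  indepSum-nonNeg {(p , u) ∷ μ} {ν} (p⁺ ∷ μ⁺) ν⁺ = ++-nonNeg (shift-nonNeg ν⁺) (indepSum-nonNeg μ⁺ ν⁺)
    where
    shift-nonNeg : ∀ {ν} → NonNeg ν → NonNeg (map (λ b → (p ℚ.* proj₁ b , addPt u (proj₂ b))) ν)
    shift-nonNeg [] = []
    shift-nonNeg (q⁺ ∷ ν⁺) = *-nonNeg p⁺ q⁺ ∷ shift-nonNeg ν⁺

  𝔼-const-prob : ∀ c μ → mass μ ≡ 1ℚ → 𝔼 (λ _ → c) μ ≡ c
  𝔼-const-prob c μ mass-μ = trans (𝔼-const c μ) (trans (cong (c ℚ.*_) mass-μ) (ℚP.*-identityʳ c))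

  mass-indepSum : ∀ μ ν → mass (indepSum μ ν) ≡ mass ν ℚ.* mass μ
  mass-indepSum μ ν = trans (𝔼-indepSum (λ _ → 1ℚ) μ ν) (𝔼-const (mass ν) μ)

  module _ (μ ν : Law) (mass-μ : mass μ ≡ 1ℚ) (mass-ν : mass ν ≡ 1ℚ) where

    𝔼-indepSum-additive : ∀ f → (∀ u w → f (addPt u w) ≡ f u ℚ.+ f w) →
                          𝔼 f (indepSum μ ν) ≡ 𝔼 f μ ℚ.+ 𝔼 f ν
    𝔼-indepSum-additive f f-additive = begin
        𝔼 f (indepSum μ ν)
      ≡⟨ 𝔼-indepSum f μ ν ⟩
        𝔼 (λ u → 𝔼 (λ w → f (addPt u w)) ν) μ
      ≡⟨ 𝔼-cong (λ u → 𝔼-cong (f-additive u) ν) μ ⟩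
        𝔼 (λ u → 𝔼 (λ w → f u ℚ.+ f w) ν) μ
      ≡⟨ 𝔼-cong (λ u → trans (𝔼-+ (λ _ → f u) f ν) (cong (ℚ._+ 𝔼 f ν) (𝔼-const-prob (f u) ν mass-ν))) μ ⟩
        𝔼 (λ u → f u ℚ.+ 𝔼 f ν) μ
      ≡⟨ trans (𝔼-+ f (λ _ → 𝔼 f ν) μ) (cong (𝔼 f μ ℚ.+_) (𝔼-const-prob (𝔼 f ν) μ mass-μ)) ⟩
        𝔼 f μ ℚ.+ 𝔼 f ν
      ∎
      where open ≡-Reasoning

    meanX-indepSum : meanX (indepSum μ ν) ≡ meanX μ ℚ.+ meanX ν
    meanX-indepSum = 𝔼-indepSum-additive X (λ { (a , _) (c , _) → fromℤ-+ a c })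

    meanY-indepSum : meanY (indepSum μ ν) ≡ meanY μ ℚ.+ meanY ν
    meanY-indepSum = 𝔼-indepSum-additive Y (λ { (_ , b) (_ , d) → fromℤ-+ b d })

    𝔼normSq-indepSum : 𝔼 normSq (indepSum μ ν) ≡
      1ℚ ℚ.* 𝔼 normSq μ ℚ.+ (meanX ν ℚ.+ meanX ν) ℚ.* meanX μ ℚ.+ (meanY ν ℚ.+ meanY ν) ℚ.* meanY μ ℚ.+ 𝔼 normSq ν
    𝔼normSq-indepSum = trans (𝔼-indepSum normSq μ ν) (trans (𝔼-cong inner μ) outer)
      where
      expand : ∀ u w → normSq (addPt u w) ≡
               1ℚ ℚ.* normSq w ℚ.+ (X u ℚ.+ X u) ℚ.* X w ℚ.+ (Y u ℚ.+ Y u) ℚ.* Y w ℚ.+ normSq u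
      expand (a , b) (c , d) rewrite fromℤ-+ a c | fromℤ-+ b d =
        solve 4 (λ x y x′ y′ → (x :+ x′) :* (x :+ x′) :+ (y :+ y′) :* (y :+ y′)
                 := con 1ℚ :* (x′ :* x′ :+ y′ :* y′) :+ (x :+ x) :* x′ :+ (y :+ y) :* y′ :+ (x :* x :+ y :* y))
          refl (fromℤ a) (fromℤ b) (fromℤ c) (fromℤ d)
      inner : ∀ u → 𝔼 (λ w → normSq (addPt u w)) ν ≡
              1ℚ ℚ.* normSq u ℚ.+ (meanX ν ℚ.+ meanX ν) ℚ.* X u ℚ.+ (meanY ν ℚ.+ meanY ν) ℚ.* Y u ℚ.+ 𝔼 normSq ν
      inner u rewrite 𝔼-cong (expand u) ν | 𝔼-quadratic 1ℚ (X u ℚ.+ X u) (Y u ℚ.+ Y u) (normSq u) ν | mass-ν =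
        solve 6 (λ e x y mx my q → con 1ℚ :* e :+ (x :+ x) :* mx :+ (y :+ y) :* my :+ q :* con 1ℚ
                 := con 1ℚ :* q :+ (mx :+ mx) :* x :+ (my :+ my) :* y :+ e)
          refl (𝔼 normSq ν) (X u) (Y u) (meanX ν) (meanY ν) (normSq u)
      outer : 𝔼 (λ u → 1ℚ ℚ.* normSq u ℚ.+ (meanX ν ℚ.+ meanX ν) ℚ.* X u ℚ.+ (meanY ν ℚ.+ meanY ν) ℚ.* Y u ℚ.+ 𝔼 normSq ν) μ ≡
              1ℚ ℚ.* 𝔼 normSq μ ℚ.+ (meanX ν ℚ.+ meanX ν) ℚ.* meanX μ ℚ.+ (meanY ν ℚ.+ meanY ν) ℚ.* meanY μ ℚ.+ 𝔼 normSq ν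
      outer rewrite 𝔼-quadratic 1ℚ (meanX ν ℚ.+ meanX ν) (meanY ν ℚ.+ meanY ν) (𝔼 normSq ν) μ | mass-μ =
        cong (1ℚ ℚ.* 𝔼 normSq μ ℚ.+ (meanX ν ℚ.+ meanX ν) ℚ.* meanX μ ℚ.+ (meanY ν ℚ.+ meanY ν) ℚ.* meanY μ ℚ.+_)
             (ℚP.*-identityʳ (𝔼 normSq ν))

    variance-indepSum : variance (indepSum μ ν) ≡ variance μ ℚ.+ variance ν
    variance-indepSum rewrite 𝔼normSq-indepSum | meanX-indepSum | meanY-indepSum =
      solve 6 (λ e x y e′ x′ y′ → con 1ℚ :* e :+ (x′ :+ x′) :* x :+ (y′ :+ y′) :* y :+ e′
                                  :- (x :+ x′) :* (x :+ x′) :- (y :+ y′) :* (y :+ y′)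
                                  := (e :- x :* x :- y :* y) :+ (e′ :- x′ :* x′ :- y′ :* y′))
        refl (𝔼 normSq μ) (meanX μ) (meanY μ) (𝔼 normSq ν) (meanX ν) (meanY ν)

module Chebyshev where

  open Casts
  open Expectation
  open import Data.Rational as ℚ using (ℚ; 0ℚ; 1ℚ; ½)
  import Data.Rational.Properties as ℚP
  open import Data.Rational.Solver using (module +-*-Solver)
  open import Data.Bool using (if_then_else_)
  open import Data.List using ([]; _∷_; foldr)
  open import Data.List.Relation.Unary.All using ([]; _∷_)
  open import Data.Product using (_,_; proj₁; proj₂)
  open import Relation.Nullary using (yes; no; does)
  open import Relation.Binary.PropositionalEquality
  open +-*-Solver

  ℙ[_≤_] : (Pt → ℚ) → ℚ → Law → ℚ
  ℙ[ g ≤ r ] = foldr (λ a s → (if does (g (proj₂ a) ℚ.≤? r) then proj₁ a else 0ℚ) ℚ.+ s) 0ℚ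

  markov : ∀ g r μ → (∀ v → 0ℚ ℚ.≤ g v) → NonNeg μ → r ℚ.* mass μ ℚ.- 𝔼 g μ ℚ.≤ r ℚ.* ℙ[ g ≤ r ] μ
  markov g r [] g⁺ [] = ℚP.≤-reflexive (solve 1 (λ r → r :* con 0ℚ :- con 0ℚ := r :* con 0ℚ) refl r)
  markov g r ((p , v) ∷ μ) g⁺ (p⁺ ∷ μ⁺) =
    subst₂ ℚ._≤_
      (solve 5 (λ r p d m e → (r :* (p :* con 1ℚ) :- p :* d) :+ (r :* m :- e) := r :* (p :* con 1ℚ :+ m) :- (p :* d :+ e))
         refl r p (g v) (mass μ) (𝔼 g μ))
      (sym (ℚP.*-distribˡ-+ r _ (ℙ[ g ≤ r ] μ)))
      (ℚP.+-mono-≤ (atom (g v ℚ.≤? r)) (markov g r μ g⁺ μ⁺))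
    where
    atom : ∀ d≤?r → r ℚ.* (p ℚ.* 1ℚ) ℚ.- p ℚ.* g v ℚ.≤ r ℚ.* (if does d≤?r then p else 0ℚ)
    atom (yes _) = 0≤q-p⇒p≤q (subst (0ℚ ℚ.≤_) gap (*-nonNeg p⁺ (g⁺ v)))
      where
      gap : p ℚ.* g v ≡ r ℚ.* p ℚ.- (r ℚ.* (p ℚ.* 1ℚ) ℚ.- p ℚ.* g v)
      gap = solve 3 (λ r p d → p :* d := r :* p :- (r :* (p :* con 1ℚ) :- p :* d)) refl r p (g v)
    atom (no d≰r) = 0≤q-p⇒p≤q (subst (0ℚ ℚ.≤_) gap (*-nonNeg p⁺ (p≤q⇒0≤q-p (ℚP.<⇒≤ (ℚP.≰⇒> d≰r)))))
      where
      gap : p ℚ.* (g v ℚ.- r) ≡ r ℚ.* 0ℚ ℚ.- (r ℚ.* (p ℚ.* 1ℚ) ℚ.- p ℚ.* g v)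
      gap = solve 3 (λ r p d → p :* (d :- r) := r :* con 0ℚ :- (r :* (p :* con 1ℚ) :- p :* d)) refl r p (g v)

  sqDist-nonNeg : ∀ mx my v → 0ℚ ℚ.≤ sqDist mx my v
  sqDist-nonNeg mx my (a , b) = ℚP.+-mono-≤ (0≤p*p (fromℤ a ℚ.- mx)) (0≤p*p (fromℤ b ℚ.- my))

  sqDist-expand : ∀ mx my v → sqDist mx my v ≡
    1ℚ ℚ.* normSq v ℚ.+ (ℚ.- (mx ℚ.+ mx)) ℚ.* X v ℚ.+ (ℚ.- (my ℚ.+ my)) ℚ.* Y v ℚ.+ (mx ℚ.* mx ℚ.+ my ℚ.* my)
  sqDist-expand mx my (a , b) =
    solve 4 (λ mx my x y → (x :- mx) :* (x :- mx) :+ (y :- my) :* (y :- my)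
             := con 1ℚ :* (x :* x :+ y :* y) :+ (:- (mx :+ mx)) :* x :+ (:- (my :+ my)) :* y :+ (mx :* mx :+ my :* my))
      refl mx my (fromℤ a) (fromℤ b)

  𝔼sqDist-mean≡variance : ∀ μ → mass μ ≡ 1ℚ → 𝔼 (sqDist (meanX μ) (meanY μ)) μ ≡ variance μ
  𝔼sqDist-mean≡variance μ mass-μ
    rewrite 𝔼-cong (sqDist-expand (meanX μ) (meanY μ)) μ
          | 𝔼-quadratic 1ℚ (ℚ.- (meanX μ ℚ.+ meanX μ)) (ℚ.- (meanY μ ℚ.+ meanY μ)) (meanX μ ℚ.* meanX μ ℚ.+ meanY μ ℚ.* meanY μ) μ
          | mass-μ =
    solve 3 (λ e x y → con 1ℚ :* e :+ (:- (x :+ x)) :* x :+ (:- (y :+ y)) :* y :+ (x :* x :+ y :* y) :* con 1ℚ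
                       := e :- x :* x :- y :* y) refl (𝔼 normSq μ) (meanX μ) (meanY μ)

  chebyshev-½ : ∀ t μ → 0ℚ ℚ.< t → NonNeg μ → mass μ ≡ 1ℚ → variance μ ℚ.≤ t → ½ ℚ.≤ discProb (t ℚ.+ t) μ
  chebyshev-½ t μ t⁺ μ⁺ mass-μ var≤t =
    ℚP.*-cancelˡ-≤-pos r {{ℚ.positive (ℚP.+-mono-< t⁺ t⁺)}} (ℚP.≤-trans r½≤r-var r-var≤rℙ)
    where
    r v : ℚ
    r = t ℚ.+ t
    v = variance μ
    r-var≤rℙ : r ℚ.* 1ℚ ℚ.- v ℚ.≤ r ℚ.* discProb r μ
    r-var≤rℙ = subst₂ (λ m e → r ℚ.* m ℚ.- e ℚ.≤ r ℚ.* discProb r μ) mass-μ (𝔼sqDist-mean≡variance μ mass-μ)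
                 (markov (sqDist (meanX μ) (meanY μ)) r μ (sqDist-nonNeg (meanX μ) (meanY μ)) μ⁺)
    r½≤r-var : r ℚ.* ½ ℚ.≤ r ℚ.* 1ℚ ℚ.- v
    r½≤r-var = 0≤q-p⇒p≤q (subst (0ℚ ℚ.≤_) gap (p≤q⇒0≤q-p var≤t))
      where
      gap : t ℚ.- v ≡ r ℚ.* 1ℚ ℚ.- v ℚ.- r ℚ.* ½
      gap = solve 2 (λ t v → t :- v := (t :+ t) :* con 1ℚ :- v :- (t :+ t) :* con ½) refl t v

module BinomialSums where

  open import Data.Nat
  open import Data.Nat.Properties
  open import Data.Nat.Combinatorics using (_C_; nCk+nC[k+1]≡[n+1]C[k+1]; k>n⇒nCk≡0)
  open import Data.Nat.Solver using (module +-*-Solver)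
  import Algebra.Properties.CommutativeSemigroup as CommSemigroupProperties
  open import Relation.Binary.PropositionalEquality
  open +-*-Solver
  open ≡-Reasoning

  private
    module +-CS = CommSemigroupProperties +-commutativeSemigroup
    module *-CS = CommSemigroupProperties *-commutativeSemigroup

  ∑< : ℕ → (ℕ → ℕ) → ℕ
  ∑< zero f = 0
  ∑< (suc n) f = f 0 + ∑< n (λ i → f (suc i))

  ∑<-cong : ∀ n {f g} → (∀ i → i < n → f i ≡ g i) → ∑< n f ≡ ∑< n g
  ∑<-cong zero f≗g = refl
  ∑<-cong (suc n) f≗g = cong₂ _+_ (f≗g 0 z<s) (∑<-cong n (λ i i<n → f≗g (suc i) (s<s i<n)))

  ∑<-+ : ∀ n f g → ∑< n (λ i → f i + g i) ≡ ∑< n f + ∑< n g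
  ∑<-+ zero f g = refl
  ∑<-+ (suc n) f g rewrite ∑<-+ n (λ i → f (suc i)) (λ i → g (suc i)) =
    +-CS.interchange (f 0) (g 0) (∑< n (λ i → f (suc i))) (∑< n (λ i → g (suc i)))

  ∑<-* : ∀ n c f → ∑< n (λ i → c * f i) ≡ c * ∑< n f
  ∑<-* zero c f = sym (*-zeroʳ c)
  ∑<-* (suc n) c f rewrite ∑<-* n c (λ i → f (suc i)) = sym (*-distribˡ-+ c (f 0) _)

  ∑<-suc : ∀ n f → ∑< (suc n) f ≡ ∑< n f + f n
  ∑<-suc zero f = +-comm (f 0) 0
  ∑<-suc (suc n) f rewrite ∑<-suc n (λ i → f (suc i)) = sym (+-assoc (f 0) _ _)

  ∑<-zero : ∀ n f → (∀ i → i < n → f i ≡ 0) → ∑< n f ≡ 0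
  ∑<-zero zero f f≡0 = refl
  ∑<-zero (suc n) f f≡0 rewrite f≡0 0 z<s = ∑<-zero n (λ i → f (suc i)) (λ i i<n → f≡0 (suc i) (s<s i<n))

  [1+x]²≡x²+2x+1 : ∀ x → suc x * suc x ≡ x * x + 2 * x + 1
  [1+x]²≡x²+2x+1 = solve 1 (λ x → (con 1 :+ x) :* (con 1 :+ x) := x :* x :+ con 2 :* x :+ con 1) refl

  binomialSum : ℕ → (ℕ → ℕ) → ℕ
  binomialSum L h = ∑< (suc L) (λ x → (L C x) * h x)

  binomialSum-cong : ∀ L {f g} → (∀ x → f x ≡ g x) → binomialSum L f ≡ binomialSum L g
  binomialSum-cong L f≗g = ∑<-cong (suc L) (λ x _ → cong ((L C x) *_) (f≗g x))

  binomialSum-+ : ∀ L f g → binomialSum L (λ x → f x + g x) ≡ binomialSum L f + binomialSum L g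
  binomialSum-+ L f g = trans (∑<-cong (suc L) (λ x _ → *-distribˡ-+ (L C x) (f x) (g x)))
                              (∑<-+ (suc L) (λ x → (L C x) * f x) (λ x → (L C x) * g x))

  binomialSum-* : ∀ L c f → binomialSum L (λ x → c * f x) ≡ c * binomialSum L f
  binomialSum-* L c f = trans (∑<-cong (suc L) (λ x _ → *-CS.x∙yz≈y∙xz (L C x) c (f x)))
                              (∑<-* (suc L) c (λ x → (L C x) * f x))

  binomialSum-suc : ∀ L h → binomialSum (suc L) h ≡ binomialSum L (λ x → h (suc x)) + binomialSum L h
  binomialSum-suc L h = begin
      1 * h 0 + ∑< (suc L) (λ i → (suc L C suc i) * h (suc i))
    ≡⟨ cong (1 * h 0 +_) (trans (∑<-cong (suc L) pascal) (∑<-+ (suc L) (λ i → (L C i) * h (suc i)) (λ i → (L C suc i) * h (suc i)))) ⟩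
      1 * h 0 + (binomialSum L (λ x → h (suc x)) + ∑< (suc L) (λ i → (L C suc i) * h (suc i)))
    ≡⟨ +-CS.x∙yz≈y∙xz (1 * h 0) (binomialSum L (λ x → h (suc x))) _ ⟩
      binomialSum L (λ x → h (suc x)) + ∑< (suc (suc L)) (λ x → (L C x) * h x)
    ≡⟨ cong (binomialSum L (λ x → h (suc x)) +_) (trans (∑<-suc (suc L) (λ x → (L C x) * h x)) top-vanishes) ⟩
      binomialSum L (λ x → h (suc x)) + binomialSum L h
    ∎
    where
    pascal : ∀ i → i < suc L → (suc L C suc i) * h (suc i) ≡ (L C i) * h (suc i) + (L C suc i) * h (suc i)
    pascal i _ = trans (cong (_* h (suc i)) (sym (nCk+nC[k+1]≡[n+1]C[k+1] L i))) (*-distribʳ-+ (h (suc i)) (L C i) (L C suc i))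
    top-vanishes : binomialSum L h + (L C suc L) * h (suc L) ≡ binomialSum L h
    top-vanishes rewrite k>n⇒nCk≡0 (n<1+n L) = +-identityʳ _

  binomialSum-1 : ∀ L → binomialSum L (λ _ → 1) ≡ 2 ^ L
  binomialSum-1 zero = refl
  binomialSum-1 (suc L) = trans (binomialSum-suc L (λ _ → 1))
    (trans (cong₂ _+_ (binomialSum-1 L) (binomialSum-1 L)) (cong (2 ^ L +_) (sym (+-identityʳ (2 ^ L)))))

  binomialSum-id : ∀ L → 2 * binomialSum L (λ x → x) ≡ L * 2 ^ L
  binomialSum-id zero = refl
  binomialSum-id (suc L) = begin
      2 * binomialSum (suc L) (λ x → x)
    ≡⟨ cong (2 *_) (binomialSum-suc L (λ x → x)) ⟩
      2 * (binomialSum L suc + B₁)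
    ≡⟨ cong (λ s → 2 * (s + B₁)) (trans (binomialSum-cong L (λ x → +-comm 1 x)) (binomialSum-+ L (λ x → x) (λ _ → 1))) ⟩
      2 * ((B₁ + B₀) + B₁)
    ≡⟨ solve 2 (λ a b → con 2 :* ((a :+ b) :+ a) := con 2 :* (con 2 :* a) :+ con 2 :* b) refl B₁ B₀ ⟩
      2 * (2 * B₁) + 2 * B₀
    ≡⟨ cong₂ (λ a b → 2 * a + 2 * b) (binomialSum-id L) (binomialSum-1 L) ⟩
      2 * (L * 2 ^ L) + 2 * 2 ^ L
    ≡⟨ solve 2 (λ l p → con 2 :* (l :* p) :+ con 2 :* p := (con 1 :+ l) :* (con 2 :* p)) refl L (2 ^ L) ⟩
      suc L * 2 ^ suc L
    ∎
    where
    B₀ B₁ : ℕ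
    B₀ = binomialSum L (λ _ → 1)
    B₁ = binomialSum L (λ x → x)

  binomialSum-square : ∀ L → 4 * binomialSum L (λ x → x * x) ≡ L * suc L * 2 ^ L
  binomialSum-square zero = refl
  binomialSum-square (suc L) = begin
      4 * binomialSum (suc L) (λ x → x * x)
    ≡⟨ cong (4 *_) (binomialSum-suc L (λ x → x * x)) ⟩
      4 * (binomialSum L (λ x → suc x * suc x) + B₂)
    ≡⟨ cong (λ s → 4 * (s + B₂)) expand ⟩
      4 * (((B₂ + 2 * B₁) + B₀) + B₂)
    ≡⟨ solve 3 (λ a b c → con 4 :* (((a :+ con 2 :* b) :+ c) :+ a) := con 2 :* (con 4 :* a) :+ con 4 :* (con 2 :* b) :+ con 4 :* c)
         refl B₂ B₁ B₀ ⟩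
      2 * (4 * B₂) + 4 * (2 * B₁) + 4 * B₀
    ≡⟨ cong₂ _+_ (cong₂ (λ a b → 2 * a + 4 * b) (binomialSum-square L) (binomialSum-id L)) (cong (4 *_) (binomialSum-1 L)) ⟩
      2 * (L * suc L * 2 ^ L) + 4 * (L * 2 ^ L) + 4 * 2 ^ L
    ≡⟨ solve 2 (λ l p → con 2 :* (l :* (con 1 :+ l) :* p) :+ con 4 :* (l :* p) :+ con 4 :* p
                        := (con 1 :+ l) :* (con 2 :+ l) :* (con 2 :* p)) refl L (2 ^ L) ⟩
      suc L * suc (suc L) * 2 ^ suc L
    ∎
    where
    B₀ B₁ B₂ : ℕ
    B₀ = binomialSum L (λ _ → 1)
    B₁ = binomialSum L (λ x → x)
    B₂ = binomialSum L (λ x → x * x)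
    expand : binomialSum L (λ x → suc x * suc x) ≡ (B₂ + 2 * B₁) + B₀
    expand = begin
        binomialSum L (λ x → suc x * suc x)
      ≡⟨ binomialSum-cong L [1+x]²≡x²+2x+1 ⟩
        binomialSum L (λ x → x * x + 2 * x + 1)
      ≡⟨ binomialSum-+ L (λ x → x * x + 2 * x) (λ _ → 1) ⟩
        binomialSum L (λ x → x * x + 2 * x) + B₀
      ≡⟨ cong (_+ B₀) (trans (binomialSum-+ L (λ x → x * x) (λ x → 2 * x)) (cong (B₂ +_) (binomialSum-* L 2 (λ x → x)))) ⟩
        (B₂ + 2 * B₁) + B₀
      ∎

module NtntSums where

  open BinomialSums using (∑<; ∑<-cong; ∑<-+; ∑<-*; ∑<-suc; ∑<-zero; [1+x]²≡x²+2x+1)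
  open import Data.Nat
  open import Data.Nat.Properties
  open import Data.Nat.Combinatorics using (_C_; nCk+nC[k+1]≡[n+1]C[k+1]; nCn≡1)
  open import Data.Nat.Solver using (module +-*-Solver)
  open import Data.Bool using (true; false)
  open import Data.Bool.Properties using (∧-zeroʳ; T-≡)
  open import Data.Empty using (⊥-elim)
  open import Data.Sum using (_⊎_; inj₁; inj₂)
  open import Function.Bundles using (Equivalence)
  open import Relation.Binary.Definitions using (tri<; tri≈; tri>)
  open import Relation.Binary.PropositionalEquality
  open import Relation.Nullary using (yes; no)
  import Algebra.Properties.CommutativeSemigroup as CommSemigroupProperties
  open +-*-Solver
  open ≡-Reasoning

  -- Indexed by m = L − 1, so that every block considered is non-empty.
  weight : ℕ → ℕ → ℕ → ℕ
  weight m = ntntWeight (suc m)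

  private
    module *-CS = CommSemigroupProperties *-commutativeSemigroup

    ≤ᵇ-true : ∀ {a b} → a ≤ b → (a ≤ᵇ b) ≡ true
    ≤ᵇ-true a≤b = Equivalence.to T-≡ (≤⇒≤ᵇ a≤b)

    ≤ᵇ-false : ∀ {a b} → b < a → (a ≤ᵇ b) ≡ false
    ≤ᵇ-false {a} {b} b<a with a ≤ᵇ b in eq
    ... | false = refl
    ... | true = ⊥-elim (<⇒≱ b<a (≤ᵇ⇒≤ a b (Equivalence.from T-≡ eq)))

  weight-inside : ∀ {a y m} → a ≤ y → y ≤ m → weight m (suc a) y ≡ (m ∸ y + a) C a
  weight-inside {a} {y} {m} a≤y y≤m rewrite ≤ᵇ-true a≤y | ≤ᵇ-true y≤m | +-∸-assoc 1 y≤m | +-suc (m ∸ y) a = refl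

  weight-outside : ∀ {a y m} → y < a ⊎ m < y → weight m (suc a) y ≡ 0
  weight-outside (inj₁ y<a) rewrite ≤ᵇ-false y<a = refl
  weight-outside {a} {y} (inj₂ m<y) rewrite ≤ᵇ-false m<y | ∧-zeroʳ (a ≤ᵇ y) = refl

  weight-diagonal : ∀ {a y} → a ≤ y → weight y (suc a) y ≡ 1
  weight-diagonal {a} {y} a≤y rewrite weight-inside a≤y (≤-refl {y}) | n∸n≡0 y = nCn≡1 a

  weight-pascal : ∀ m a y → weight (suc m) (suc (suc a)) (suc y) ≡ weight m (suc (suc a)) (suc y) + weight m (suc a) y
  weight-pascal m a y with y <? a
  ... | yes y<a rewrite weight-outside {suc a} {suc y} {suc m} (inj₁ (s<s y<a))
                      | weight-outside {suc a} {suc y} {m} (inj₁ (s<s y<a))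
                      | weight-outside {a} {y} {m} (inj₁ y<a) = refl
  ... | no y≮a with ≮⇒≥ y≮a | <-cmp y m
  ...   | a≤y | tri> _ _ m<y rewrite weight-outside {suc a} {suc y} {suc m} (inj₂ (s<s m<y))
                                   | weight-outside {suc a} {suc y} {m} (inj₂ (m<n⇒m<1+n m<y))
                                   | weight-outside {a} {y} {m} (inj₂ m<y) = refl
  ...   | a≤y | tri≈ _ refl _ rewrite weight-diagonal (s≤s a≤y)
                                   | weight-outside {suc a} {suc y} {y} (inj₂ (n<1+n y))
                                   | weight-diagonal a≤y = refl
  ...   | a≤y | tri< y<m _ _ = begin
      weight (suc m) (suc (suc a)) (suc y)
    ≡⟨ weight-inside (s≤s a≤y) (s≤s (<⇒≤ y<m)) ⟩
      (m ∸ y + suc a) C suc a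
    ≡⟨ cong (λ z → (z + suc a) C suc a) m∸y≡1+k ⟩
      suc (k + suc a) C suc a
    ≡⟨ sym (nCk+nC[k+1]≡[n+1]C[k+1] (k + suc a) a) ⟩
      (k + suc a) C a + (k + suc a) C suc a
    ≡⟨ +-comm ((k + suc a) C a) _ ⟩
      (k + suc a) C suc a + (k + suc a) C a
    ≡⟨ cong₂ _+_ (sym (weight-inside (s≤s a≤y) y<m)) (cong (_C a) (trans (+-suc k a) (cong (_+ a) (sym m∸y≡1+k)))) ⟩
      weight m (suc (suc a)) (suc y) + (m ∸ y + a) C a
    ≡⟨ cong (weight m (suc (suc a)) (suc y) +_) (sym (weight-inside a≤y (<⇒≤ y<m))) ⟩
      weight m (suc (suc a)) (suc y) + weight m (suc a) y
    ∎
    where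
    k : ℕ
    k = m ∸ suc y
    m∸y≡1+k : m ∸ y ≡ suc k
    m∸y≡1+k = +-∸-assoc 1 y<m

  ntntRow : ℕ → ℕ → (ℕ → ℕ → ℕ) → ℕ
  ntntRow m x h = ∑< (suc (suc m)) (λ y → weight m x y * h x y)

  ntntSum : ℕ → (ℕ → ℕ → ℕ) → ℕ
  ntntSum m h = ∑< (suc (suc m)) (λ x → ntntRow m x h)

  shift : (ℕ → ℕ → ℕ) → ℕ → ℕ → ℕ
  shift h x y = h (suc x) (suc y)

  ntntRow-0 : ∀ m h → ntntRow m 0 h ≡ 0
  ntntRow-0 m h = ∑<-zero (suc (suc m)) _ (λ _ _ → refl)

  ntntRow-1 : ∀ m h → ntntRow m 1 h ≡ ∑< (suc m) (h 1)
  ntntRow-1 m h = begin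
      ntntRow m 1 h
    ≡⟨ ∑<-suc (suc m) (λ y → weight m 1 y * h 1 y) ⟩
      ∑< (suc m) (λ y → weight m 1 y * h 1 y) + weight m 1 (suc m) * h 1 (suc m)
    ≡⟨ cong₂ _+_ (∑<-cong (suc m) (λ y y≤m → trans (cong (_* h 1 y) (weight-inside z≤n (≤-pred y≤m))) (+-identityʳ (h 1 y))))
                 (cong (_* h 1 (suc m)) (weight-outside {0} {suc m} {m} (inj₂ (n<1+n m)))) ⟩
      ∑< (suc m) (h 1) + 0
    ≡⟨ +-identityʳ _ ⟩
      ∑< (suc m) (h 1)
    ∎

  ntntRow-top : ∀ m h → ntntRow m (suc (suc m)) h ≡ 0
  ntntRow-top m h = ∑<-zero (suc (suc m)) _ (λ y _ → cong (_* h (suc (suc m)) y) (weight-outside (y<1+m⊎m<y y)))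
    where
    y<1+m⊎m<y : ∀ y → y < suc m ⊎ m < y
    y<1+m⊎m<y y with y <? suc m
    ... | yes y<1+m = inj₁ y<1+m
    ... | no y≮1+m = inj₂ (≮⇒≥ y≮1+m)

  ntntRow-suc : ∀ m a h → ntntRow (suc m) (suc (suc a)) h ≡ ntntRow m (suc (suc a)) h + ntntRow m (suc a) (shift h)
  ntntRow-suc m a h = begin
      ∑< (suc (suc m)) (λ y → weight (suc m) (suc (suc a)) (suc y) * h (2 + a) (suc y))
    ≡⟨ ∑<-cong (suc (suc m)) (λ y _ → trans (cong (_* h (2 + a) (suc y)) (weight-pascal m a y))
          (*-distribʳ-+ (h (2 + a) (suc y)) (weight m (2 + a) (suc y)) (weight m (suc a) y))) ⟩
      ∑< (suc (suc m)) (λ y → weight m (2 + a) (suc y) * h (2 + a) (suc y) + weight m (suc a) y * h (2 + a) (suc y))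
    ≡⟨ ∑<-+ (suc (suc m)) (λ y → weight m (2 + a) (suc y) * h (2 + a) (suc y)) (λ y → weight m (suc a) y * h (2 + a) (suc y)) ⟩
      ∑< (suc (suc m)) (λ y → weight m (2 + a) (suc y) * h (2 + a) (suc y)) + ntntRow m (suc a) (shift h)
    ≡⟨ cong (_+ ntntRow m (suc a) (shift h)) (trans (∑<-suc (suc m) (λ y → weight m (2 + a) (suc y) * h (2 + a) (suc y))) last-vanishes) ⟩
      ntntRow m (suc (suc a)) h + ntntRow m (suc a) (shift h)
    ∎
    where
    last-vanishes : ∑< (suc m) (λ y → weight m (2 + a) (suc y) * h (2 + a) (suc y)) + weight m (2 + a) (2 + m) * h (2 + a) (2 + m)
                    ≡ ntntRow m (2 + a) h
    last-vanishes rewrite weight-outside {suc a} {2 + m} {m} (inj₂ (m≤n⇒m≤1+n (n<1+n m))) = +-identityʳ _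

  -- Pascal's rule for the weights: the block of length m+2 splits into the block of length m+1,
  -- its translate by (1,1), and the single atom (1, m+1).
  ntntSum-suc : ∀ m h → ntntSum (suc m) h ≡ ntntSum m h + ntntSum m (shift h) + h 1 (suc m)
  ntntSum-suc m h = begin
      ntntRow (suc m) 0 h + (ntntRow (suc m) 1 h + ∑< (suc m) (λ a → ntntRow (suc m) (2 + a) h))
    ≡⟨ cong₂ _+_ (ntntRow-0 (suc m) h) (cong₂ _+_ (trans (ntntRow-1 (suc m) h) (∑<-suc (suc m) (h 1)))
         (trans (∑<-cong (suc m) (λ a _ → ntntRow-suc m a h)) (∑<-+ (suc m) (λ a → ntntRow m (2 + a) h) (λ a → ntntRow m (suc a) (shift h))))) ⟩
      0 + ((R₁ + t) + (∑< (suc m) (λ a → ntntRow m (2 + a) h) + B))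
    ≡⟨ cong (λ z → 0 + ((R₁ + t) + (z + B))) (trans (∑<-suc m (λ a → ntntRow m (2 + a) h)) (trans (cong (A +_) (ntntRow-top m h)) (+-identityʳ A))) ⟩
      0 + ((R₁ + t) + (A + B))
    ≡⟨ solve 4 (λ r t a b → con 0 :+ ((r :+ t) :+ (a :+ b)) := (r :+ a) :+ b :+ t) refl R₁ t A B ⟩
      (R₁ + A) + B + t
    ≡⟨ cong₂ (λ u v → u + v + t) (sym (cong₂ _+_ (ntntRow-0 m h) (cong (_+ A) (ntntRow-1 m h)))) (sym (cong (_+ B) (ntntRow-0 m (shift h)))) ⟩
      ntntSum m h + ntntSum m (shift h) + h 1 (suc m)
    ∎
    where
    R₁ t A B : ℕ
    R₁ = ∑< (suc m) (h 1)
    t = h 1 (suc m)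
    A = ∑< m (λ a → ntntRow m (2 + a) h)
    B = ∑< (suc m) (λ a → ntntRow m (suc a) (shift h))

  ntntSum-cong : ∀ m {f g} → (∀ x y → f x y ≡ g x y) → ntntSum m f ≡ ntntSum m g
  ntntSum-cong m f≗g = ∑<-cong (suc (suc m)) (λ x _ → ∑<-cong (suc (suc m)) (λ y _ → cong (weight m x y *_) (f≗g x y)))

  ntntSum-+ : ∀ m f g → ntntSum m (λ x y → f x y + g x y) ≡ ntntSum m f + ntntSum m g
  ntntSum-+ m f g = trans
    (∑<-cong (suc (suc m)) (λ x _ → trans (∑<-cong (suc (suc m)) (λ y _ → *-distribˡ-+ (weight m x y) (f x y) (g x y)))
                                          (∑<-+ (suc (suc m)) (λ y → weight m x y * f x y) (λ y → weight m x y * g x y))))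
    (∑<-+ (suc (suc m)) (λ x → ntntRow m x f) (λ x → ntntRow m x g))

  ntntSum-* : ∀ m c f → ntntSum m (λ x y → c * f x y) ≡ c * ntntSum m f
  ntntSum-* m c f = trans
    (∑<-cong (suc (suc m)) (λ x _ → trans (∑<-cong (suc (suc m)) (λ y _ → *-CS.x∙yz≈y∙xz (weight m x y) c (f x y)))
                                          (∑<-* (suc (suc m)) c (λ y → weight m x y * f x y))))
    (∑<-* (suc (suc m)) c (λ x → ntntRow m x f))

  module _ (m : ℕ) (g : ℕ → ℕ → ℕ) where

    ntntSum-1+ : ntntSum m (λ x y → suc (g x y)) ≡ ntntSum m g + ntntSum m (λ _ _ → 1)
    ntntSum-1+ = trans (ntntSum-cong m (λ x y → +-comm 1 (g x y))) (ntntSum-+ m g (λ _ _ → 1))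

    ntntSum-[1+]² : ntntSum m (λ x y → suc (g x y) * suc (g x y)) ≡
                    (ntntSum m (λ x y → g x y * g x y) + 2 * ntntSum m g) + ntntSum m (λ _ _ → 1)
    ntntSum-[1+]² = begin
        ntntSum m (λ x y → suc (g x y) * suc (g x y))
      ≡⟨ ntntSum-cong m (λ x y → [1+x]²≡x²+2x+1 (g x y)) ⟩
        ntntSum m (λ x y → g x y * g x y + 2 * g x y + 1)
      ≡⟨ ntntSum-+ m (λ x y → g x y * g x y + 2 * g x y) (λ _ _ → 1) ⟩
        ntntSum m (λ x y → g x y * g x y + 2 * g x y) + ntntSum m (λ _ _ → 1)
      ≡⟨ cong (_+ ntntSum m (λ _ _ → 1)) (trans (ntntSum-+ m (λ x y → g x y * g x y) (λ x y → 2 * g x y))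
                                                 (cong (ntntSum m (λ x y → g x y * g x y) +_) (ntntSum-* m 2 g))) ⟩
        (ntntSum m (λ x y → g x y * g x y) + 2 * ntntSum m g) + ntntSum m (λ _ _ → 1)
      ∎

  ntntSum-1 : ∀ m → ntntSum m (λ _ _ → 1) + 1 ≡ 2 * 2 ^ m
  ntntSum-1 zero = refl
  ntntSum-1 (suc m) = begin
      ntntSum (suc m) (λ _ _ → 1) + 1
    ≡⟨ cong (_+ 1) (ntntSum-suc m (λ _ _ → 1)) ⟩
      S₀ + S₀ + 1 + 1
    ≡⟨ solve 1 (λ a → a :+ a :+ con 1 :+ con 1 := con 2 :* (a :+ con 1)) refl S₀ ⟩
      2 * (S₀ + 1)
    ≡⟨ cong (2 *_) (ntntSum-1 m) ⟩
      2 * 2 ^ suc m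
    ∎
    where
    S₀ : ℕ
    S₀ = ntntSum m (λ _ _ → 1)

  ntntSum-x : ∀ m → ntntSum m (λ x _ → x) ≡ suc m * 2 ^ m
  ntntSum-x zero = refl
  ntntSum-x (suc m) = begin
      ntntSum (suc m) (λ x _ → x)
    ≡⟨ trans (ntntSum-suc m (λ x _ → x)) (cong (λ z → S₁ + z + 1) (ntntSum-1+ m (λ x _ → x))) ⟩
      S₁ + (S₁ + S₀) + 1
    ≡⟨ solve 2 (λ a b → a :+ (a :+ b) :+ con 1 := con 2 :* a :+ (b :+ con 1)) refl S₁ S₀ ⟩
      2 * S₁ + (S₀ + 1)
    ≡⟨ cong₂ (λ u v → 2 * u + v) (ntntSum-x m) (ntntSum-1 m) ⟩
      2 * (suc m * 2 ^ m) + 2 * 2 ^ m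
    ≡⟨ solve 2 (λ l p → con 2 :* ((con 1 :+ l) :* p) :+ con 2 :* p := (con 2 :+ l) :* (con 2 :* p)) refl m (2 ^ m) ⟩
      suc (suc m) * 2 ^ suc m
    ∎
    where
    S₀ S₁ : ℕ
    S₀ = ntntSum m (λ _ _ → 1)
    S₁ = ntntSum m (λ x _ → x)

  ntntSum-y : ∀ m → ntntSum m (λ _ y → y) + suc m ≡ suc m * 2 ^ m
  ntntSum-y zero = refl
  ntntSum-y (suc m) = begin
      ntntSum (suc m) (λ _ y → y) + suc (suc m)
    ≡⟨ cong (_+ suc (suc m)) (trans (ntntSum-suc m (λ _ y → y)) (cong (λ z → S₁ + z + suc m) (ntntSum-1+ m (λ _ y → y)))) ⟩
      S₁ + (S₁ + S₀) + suc m + suc (suc m)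
    ≡⟨ solve 3 (λ a b l → a :+ (a :+ b) :+ (con 1 :+ l) :+ (con 2 :+ l) := con 2 :* (a :+ (con 1 :+ l)) :+ (b :+ con 1)) refl S₁ S₀ m ⟩
      2 * (S₁ + suc m) + (S₀ + 1)
    ≡⟨ cong₂ (λ u v → 2 * u + v) (ntntSum-y m) (ntntSum-1 m) ⟩
      2 * (suc m * 2 ^ m) + 2 * 2 ^ m
    ≡⟨ solve 2 (λ l p → con 2 :* ((con 1 :+ l) :* p) :+ con 2 :* p := (con 2 :+ l) :* (con 2 :* p)) refl m (2 ^ m) ⟩
      suc (suc m) * 2 ^ suc m
    ∎
    where
    S₀ S₁ : ℕ
    S₀ = ntntSum m (λ _ _ → 1)
    S₁ = ntntSum m (λ _ y → y)

  ntntSum-xx : ∀ m → 2 * ntntSum m (λ x _ → x * x) ≡ suc m * suc (suc m) * 2 ^ m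
  ntntSum-xx zero = refl
  ntntSum-xx (suc m) = begin
      2 * ntntSum (suc m) (λ x _ → x * x)
    ≡⟨ cong (2 *_) (trans (ntntSum-suc m (λ x _ → x * x)) (cong (λ z → S₂ + z + 1) (ntntSum-[1+]² m (λ x _ → x)))) ⟩
      2 * (S₂ + ((S₂ + 2 * S₁) + S₀) + 1)
    ≡⟨ solve 3 (λ a b c → con 2 :* (a :+ ((a :+ con 2 :* b) :+ c) :+ con 1) := con 2 :* (con 2 :* a) :+ con 4 :* b :+ con 2 :* (c :+ con 1))
         refl S₂ S₁ S₀ ⟩
      2 * (2 * S₂) + 4 * S₁ + 2 * (S₀ + 1)
    ≡⟨ cong₂ _+_ (cong₂ (λ u v → 2 * u + 4 * v) (ntntSum-xx m) (ntntSum-x m)) (cong (2 *_) (ntntSum-1 m)) ⟩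
      2 * (suc m * suc (suc m) * 2 ^ m) + 4 * (suc m * 2 ^ m) + 2 * (2 * 2 ^ m)
    ≡⟨ solve 2 (λ l p → con 2 :* ((con 1 :+ l) :* (con 2 :+ l) :* p) :+ con 4 :* ((con 1 :+ l) :* p) :+ con 2 :* (con 2 :* p)
                        := (con 2 :+ l) :* (con 3 :+ l) :* (con 2 :* p)) refl m (2 ^ m) ⟩
      suc (suc m) * suc (suc (suc m)) * 2 ^ suc m
    ∎
    where
    S₀ S₁ S₂ : ℕ
    S₀ = ntntSum m (λ _ _ → 1)
    S₁ = ntntSum m (λ x _ → x)
    S₂ = ntntSum m (λ x _ → x * x)

  ntntSum-yy : ∀ m → 2 * ntntSum m (λ _ y → y * y) + 2 * (suc m * suc m) ≡ suc m * suc (suc m) * 2 ^ m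
  ntntSum-yy zero = refl
  ntntSum-yy (suc m) = begin
      2 * ntntSum (suc m) (λ _ y → y * y) + 2 * (suc (suc m) * suc (suc m))
    ≡⟨ cong (λ z → 2 * z + 2 * (suc (suc m) * suc (suc m)))
         (trans (ntntSum-suc m (λ _ y → y * y)) (cong (λ z → S₂ + z + suc m * suc m) (ntntSum-[1+]² m (λ _ y → y)))) ⟩
      2 * (S₂ + ((S₂ + 2 * S₁) + S₀) + suc m * suc m) + 2 * (suc (suc m) * suc (suc m))
    ≡⟨ solve 4 (λ a b c l → con 2 :* (a :+ ((a :+ con 2 :* b) :+ c) :+ (con 1 :+ l) :* (con 1 :+ l)) :+ con 2 :* ((con 2 :+ l) :* (con 2 :+ l))
         := con 2 :* (con 2 :* a :+ con 2 :* ((con 1 :+ l) :* (con 1 :+ l))) :+ con 4 :* (b :+ (con 1 :+ l)) :+ con 2 :* (c :+ con 1))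
         refl S₂ S₁ S₀ m ⟩
      2 * (2 * S₂ + 2 * (suc m * suc m)) + 4 * (S₁ + suc m) + 2 * (S₀ + 1)
    ≡⟨ cong₂ _+_ (cong₂ (λ u v → 2 * u + 4 * v) (ntntSum-yy m) (ntntSum-y m)) (cong (2 *_) (ntntSum-1 m)) ⟩
      2 * (suc m * suc (suc m) * 2 ^ m) + 4 * (suc m * 2 ^ m) + 2 * (2 * 2 ^ m)
    ≡⟨ solve 2 (λ l p → con 2 :* ((con 1 :+ l) :* (con 2 :+ l) :* p) :+ con 4 :* ((con 1 :+ l) :* p) :+ con 2 :* (con 2 :* p)
                        := (con 2 :+ l) :* (con 3 :+ l) :* (con 2 :* p)) refl m (2 ^ m) ⟩
      suc (suc m) * suc (suc (suc m)) * 2 ^ suc m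
    ∎
    where
    S₀ S₁ S₂ : ℕ
    S₀ = ntntSum m (λ _ _ → 1)
    S₁ = ntntSum m (λ _ y → y)
    S₂ = ntntSum m (λ _ y → y * y)

module MomentInequalities where

  open import Data.Nat
  open import Data.Nat.Properties
  open import Data.Nat.Solver using (module +-*-Solver)
  open import Relation.Binary.PropositionalEquality
  open +-*-Solver
  open ≡-Reasoning

  trivial-moment-inequality : ∀ L D T₁ T₂ → 2 * T₁ ≡ L * D → 4 * T₂ ≡ L * suc L * D →
                              2 * (T₂ + T₂) + L * L * D ≤ 2 * L * (T₁ + T₁) + 2 * L * D
  trivial-moment-inequality L D T₁ T₂ hT₁ hT₂ = *-cancelˡ-≤ 2 (subst₂ _≤_ (sym lhs) (sym rhs) (m≤m+n _ _))
    where
    lhs : 2 * (2 * (T₂ + T₂) + L * L * D) ≡ 2 * (L * suc L * D) + 2 * (L * L * D)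
    lhs = begin
        2 * (2 * (T₂ + T₂) + L * L * D)
      ≡⟨ solve 3 (λ t l d → con 2 :* (con 2 :* (t :+ t) :+ l :* l :* d) := con 2 :* (con 4 :* t) :+ con 2 :* (l :* l :* d)) refl T₂ L D ⟩
        2 * (4 * T₂) + 2 * (L * L * D)
      ≡⟨ cong (λ z → 2 * z + 2 * (L * L * D)) hT₂ ⟩
        2 * (L * suc L * D) + 2 * (L * L * D)
      ∎
    rhs : 2 * (2 * L * (T₁ + T₁) + 2 * L * D) ≡ 2 * (L * suc L * D) + 2 * (L * L * D) + 2 * L * D
    rhs = begin
        2 * (2 * L * (T₁ + T₁) + 2 * L * D)
      ≡⟨ solve 3 (λ t l d → con 2 :* (con 2 :* l :* (t :+ t) :+ con 2 :* l :* d) := con 4 :* l :* (con 2 :* t) :+ con 4 :* l :* d) refl T₁ L D ⟩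
        4 * L * (2 * T₁) + 4 * L * D
      ≡⟨ cong (λ z → 4 * L * z + 4 * L * D) hT₁ ⟩
        4 * L * (L * D) + 4 * L * D
      ≡⟨ solve 2 (λ l d → con 4 :* l :* (l :* d) :+ con 4 :* l :* d
                          := con 2 :* (l :* (con 1 :+ l) :* d) :+ con 2 :* (l :* l :* d) :+ con 2 :* l :* d) refl L D ⟩
        2 * (L * suc L * D) + 2 * (L * L * D) + 2 * L * D
      ∎

  -- Here 2^(L-1) = q + 1, so that A = 2^L - 1 = 2q + 1 is the total weight.
  ntnt-moment-inequality : ∀ L q A Sx Sy Sxx Syy → A ≡ 1 + 2 * q → Sx ≡ L * suc q → Sy + L ≡ L * suc q →
                           2 * Sxx ≡ L * suc L * suc q → 2 * Syy + 2 * (L * L) ≡ L * suc L * suc q →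
                           2 * (Sxx + Syy) + L * L * A ≤ 2 * L * (Sx + Sy) + 2 * L * A
  ntnt-moment-inequality L q A Sx Sy Sxx Syy hA hx hy hxx hyy =
    *-cancelˡ-≤ 2 (+-cancelʳ-≤ (4 * (L * L)) _ _ (subst₂ _≤_ (sym lhs) (sym rhs) (m≤m+n _ (2 * (L * L) + 4 * L * q))))
    where
    common : ℕ
    common = 2 * (L * suc L * suc q) + 2 * (L * suc L * suc q) + 2 * (L * L * (1 + 2 * q))
    hy′ : Sy ≡ L * q
    hy′ = +-cancelʳ-≡ L Sy (L * q) (trans hy (solve 2 (λ l q → l :* (con 1 :+ q) := l :* q :+ l) refl L q))
    lhs : 2 * (2 * (Sxx + Syy) + L * L * A) + 4 * (L * L) ≡ common
    lhs = begin
        2 * (2 * (Sxx + Syy) + L * L * A) + 4 * (L * L)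
      ≡⟨ solve 4 (λ a b l c → con 2 :* (con 2 :* (a :+ b) :+ l :* l :* c) :+ con 4 :* (l :* l)
            := con 2 :* (con 2 :* a) :+ con 2 :* (con 2 :* b :+ con 2 :* (l :* l)) :+ con 2 :* (l :* l :* c)) refl Sxx Syy L A ⟩
        2 * (2 * Sxx) + 2 * (2 * Syy + 2 * (L * L)) + 2 * (L * L * A)
      ≡⟨ cong₂ _+_ (cong₂ (λ u v → 2 * u + 2 * v) hxx hyy) (cong (λ z → 2 * (L * L * z)) hA) ⟩
        common
      ∎
    rhs : 2 * (2 * L * (Sx + Sy) + 2 * L * A) + 4 * (L * L) ≡ common + (2 * (L * L) + 4 * L * q)
    rhs = begin
        2 * (2 * L * (Sx + Sy) + 2 * L * A) + 4 * (L * L)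
      ≡⟨ cong₂ (λ u v → 2 * (2 * L * u + 2 * L * v) + 4 * (L * L)) (cong₂ _+_ hx hy′) hA ⟩
        2 * (2 * L * (L * suc q + L * q) + 2 * L * (1 + 2 * q)) + 4 * (L * L)
      ≡⟨ solve 2 (λ l q → con 2 :* (con 2 :* l :* (l :* (con 1 :+ q) :+ l :* q) :+ con 2 :* l :* (con 1 :+ con 2 :* q)) :+ con 4 :* (l :* l)
           := con 2 :* (l :* (con 1 :+ l) :* (con 1 :+ q)) :+ con 2 :* (l :* (con 1 :+ l) :* (con 1 :+ q))
              :+ con 2 :* (l :* l :* (con 1 :+ con 2 :* q)) :+ (con 2 :* (l :* l) :+ con 4 :* l :* q)) refl L q ⟩
        common + (2 * (L * L) + 4 * L * q)
      ∎

module Blocks where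

  open Casts
  open Expectation
  open BinomialSums
  open NtntSums
  open MomentInequalities
  open import Data.Nat as ℕ using (ℕ; zero; suc; _^_; _∸_)
  import Data.Nat.Properties as ℕP
  open import Data.Nat.Combinatorics using (_C_)
  open import Data.Integer using (+_)
  open import Data.Rational as ℚ using (ℚ; 0ℚ; 1ℚ; _/_)
  import Data.Rational.Properties as ℚP
  open import Data.Rational.Solver using (module +-*-Solver)
  open import Data.List using ([]; _∷_; map; concatMap; _++_; applyUpTo; upTo)
  open import Data.List.Relation.Unary.All using (All; []; _∷_)
  open import Function using (id)
  open import Data.Product using (_×_; _,_; proj₁; proj₂)
  open import Relation.Binary.PropositionalEquality
  open +-*-Solver
  open ≡-Reasoning

  tabulate-nonNeg : ∀ d .{{_ : ℕ.NonZero d}} (wt : ℕ → ℕ) (v : ℕ → Pt) xs → NonNeg (map (λ i → ((+ wt i) / d , v i)) xs)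
  tabulate-nonNeg d wt v [] = []
  tabulate-nonNeg d wt v (i ∷ xs) = w/d-nonNeg (wt i) d ∷ tabulate-nonNeg d wt v xs

  concatMap-nonNeg : ∀ (F : ℕ → Law) → (∀ x → NonNeg (F x)) → ∀ xs → NonNeg (concatMap F xs)
  concatMap-nonNeg F F⁺ [] = []
  concatMap-nonNeg F F⁺ (x ∷ xs) = ++-nonNeg (F⁺ x) (concatMap-nonNeg F F⁺ xs)

  𝔼-tabulate : ∀ d .{{_ : ℕ.NonZero d}} (wt : ℕ → ℕ) (v : ℕ → Pt) f (h : ℕ → ℕ) → (∀ i → f (v i) ≡ fromℕ (h i)) →
               ∀ g n → fromℕ d ℚ.* 𝔼 f (map (λ i → ((+ wt i) / d , v i)) (applyUpTo g n)) ≡ fromℕ (∑< n (λ i → wt (g i) ℕ.* h (g i)))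
  𝔼-tabulate d wt v f h f∘v g zero = ℚP.*-zeroʳ (fromℕ d)
  𝔼-tabulate d wt v f h f∘v g (suc n) = begin
      D ℚ.* ((+ wt (g 0)) / d ℚ.* f (v (g 0)) ℚ.+ 𝔼 f rest)
    ≡⟨ ℚP.*-distribˡ-+ D ((+ wt (g 0)) / d ℚ.* f (v (g 0))) (𝔼 f rest) ⟩
      D ℚ.* ((+ wt (g 0)) / d ℚ.* f (v (g 0))) ℚ.+ D ℚ.* 𝔼 f rest
    ≡⟨ cong₂ ℚ._+_ (trans (sym (ℚP.*-assoc D ((+ wt (g 0)) / d) (f (v (g 0))))) (cong₂ ℚ._*_ (d*[w/d]≡w d (wt (g 0))) (f∘v (g 0))))
                   (𝔼-tabulate d wt v f h f∘v (λ i → g (suc i)) n) ⟩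
      fromℕ (wt (g 0)) ℚ.* fromℕ (h (g 0)) ℚ.+ fromℕ (∑< n (λ i → wt (g (suc i)) ℕ.* h (g (suc i))))
    ≡⟨ trans (cong (ℚ._+ fromℕ Σrest) (sym (fromℕ-* (wt (g 0)) (h (g 0))))) (sym (fromℕ-+ (wt (g 0) ℕ.* h (g 0)) Σrest)) ⟩
      fromℕ (∑< (suc n) (λ i → wt (g i) ℕ.* h (g i)))
    ∎
    where
    D : ℚ
    D = fromℕ d
    rest : Law
    rest = map (λ i → ((+ wt i) / d , v i)) (applyUpTo (λ i → g (suc i)) n)
    Σrest : ℕ
    Σrest = ∑< n (λ i → wt (g (suc i)) ℕ.* h (g (suc i)))

  𝔼-concatMap : ∀ d f (F : ℕ → Law) (R : ℕ → ℕ) → (∀ x → fromℕ d ℚ.* 𝔼 f (F x) ≡ fromℕ (R x)) →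
                ∀ g n → fromℕ d ℚ.* 𝔼 f (concatMap F (applyUpTo g n)) ≡ fromℕ (∑< n (λ i → R (g i)))
  𝔼-concatMap d f F R hF g zero = ℚP.*-zeroʳ (fromℕ d)
  𝔼-concatMap d f F R hF g (suc n) = begin
      fromℕ d ℚ.* 𝔼 f (F (g 0) ++ rest)
    ≡⟨ trans (cong (fromℕ d ℚ.*_) (𝔼-++ f (F (g 0)) rest)) (ℚP.*-distribˡ-+ (fromℕ d) (𝔼 f (F (g 0))) (𝔼 f rest)) ⟩
      fromℕ d ℚ.* 𝔼 f (F (g 0)) ℚ.+ fromℕ d ℚ.* 𝔼 f rest
    ≡⟨ cong₂ ℚ._+_ (hF (g 0)) (𝔼-concatMap d f F R hF (λ i → g (suc i)) n) ⟩
      fromℕ (R (g 0)) ℚ.+ fromℕ (∑< n (λ i → R (g (suc i))))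
    ≡⟨ sym (fromℕ-+ (R (g 0)) (∑< n (λ i → R (g (suc i))))) ⟩
      fromℕ (∑< (suc n) (λ i → R (g i)))
    ∎
    where
    rest : Law
    rest = concatMap F (applyUpTo (λ i → g (suc i)) n)

  normSq-fromℕ : ∀ x y → normSq (+ x , + y) ≡ fromℕ (x ℕ.* x ℕ.+ y ℕ.* y)
  normSq-fromℕ x y = sym (trans (fromℕ-+ (x ℕ.* x) (y ℕ.* y)) (cong₂ ℚ._+_ (fromℕ-* x x) (fromℕ-* y y)))

  -- The hypothesis says that the second moment about (ℓ/2, ℓ/2) is at most ℓ, and no second moment
  -- about a point is smaller than the variance.
  e-x²-y²≤ℓ : ∀ e x y ℓ → (e ℚ.+ e) ℚ.+ ℓ ℚ.* ℓ ℚ.≤ (ℓ ℚ.+ ℓ) ℚ.* (x ℚ.+ y) ℚ.+ (ℓ ℚ.+ ℓ) →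
              e ℚ.- x ℚ.* x ℚ.- y ℚ.* y ℚ.≤ ℓ
  e-x²-y²≤ℓ e x y ℓ hyp = ℚP.*-cancelˡ-≤-pos four {{ℚ.positive (fromℕ-pos 4)}} (0≤q-p⇒p≤q (subst (0ℚ ℚ.≤_) sum-of-squares 0≤sum))
    where
    four Δ sx sy : ℚ
    four = fromℕ 4
    Δ = (ℓ ℚ.+ ℓ) ℚ.* (x ℚ.+ y) ℚ.+ (ℓ ℚ.+ ℓ) ℚ.- ((e ℚ.+ e) ℚ.+ ℓ ℚ.* ℓ)
    sx = x ℚ.+ x ℚ.- ℓ
    sy = y ℚ.+ y ℚ.- ℓ
    0≤sum : 0ℚ ℚ.≤ (Δ ℚ.+ Δ) ℚ.+ sx ℚ.* sx ℚ.+ sy ℚ.* sy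
    0≤sum = ℚP.+-mono-≤ (ℚP.+-mono-≤ (ℚP.+-mono-≤ (p≤q⇒0≤q-p hyp) (p≤q⇒0≤q-p hyp)) (0≤p*p sx)) (0≤p*p sy)
    sum-of-squares : (Δ ℚ.+ Δ) ℚ.+ sx ℚ.* sx ℚ.+ sy ℚ.* sy ≡ four ℚ.* ℓ ℚ.- four ℚ.* (e ℚ.- x ℚ.* x ℚ.- y ℚ.* y)
    sum-of-squares = solve 4 (λ e x y ℓ →
        let δ = (ℓ :+ ℓ) :* (x :+ y) :+ (ℓ :+ ℓ) :- ((e :+ e) :+ ℓ :* ℓ) in
        (δ :+ δ) :+ (x :+ x :- ℓ) :* (x :+ x :- ℓ) :+ (y :+ y :- ℓ) :* (y :+ y :- ℓ)
        := con four :* ℓ :- con four :* (e :- x :* x :- y :* y)) refl e x y ℓ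

  moments⇒variance≤ : ∀ μ L d .{{_ : ℕ.NonZero d}} Nx Ny N2 →
    fromℕ d ℚ.* mass μ ≡ fromℕ d → fromℕ d ℚ.* meanX μ ≡ fromℕ Nx → fromℕ d ℚ.* meanY μ ≡ fromℕ Ny →
    fromℕ d ℚ.* 𝔼 normSq μ ≡ fromℕ N2 → 2 ℕ.* N2 ℕ.+ L ℕ.* L ℕ.* d ℕ.≤ 2 ℕ.* L ℕ.* (Nx ℕ.+ Ny) ℕ.+ 2 ℕ.* L ℕ.* d →
    mass μ ≡ 1ℚ × variance μ ℚ.≤ fromℕ L
  moments⇒variance≤ μ L d Nx Ny N2 hm hx hy h2 ineq =
    ℚP.≤-antisym (cancel (ℚP.≤-reflexive d*mass≡d*1)) (cancel (ℚP.≤-reflexive (sym d*mass≡d*1))) ,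
    e-x²-y²≤ℓ (𝔼 normSq μ) (meanX μ) (meanY μ) ℓ (cancel (subst₂ ℚ._≤_ lhs rhs (fromℕ-mono-≤ ineq)))
    where
    D ℓ two : ℚ
    D = fromℕ d
    ℓ = fromℕ L
    two = fromℕ 2
    cancel : ∀ {p q} → D ℚ.* p ℚ.≤ D ℚ.* q → p ℚ.≤ q
    cancel = ℚP.*-cancelˡ-≤-pos D {{ℚ.positive (fromℕ-pos d)}}
    d*mass≡d*1 : D ℚ.* mass μ ≡ D ℚ.* 1ℚ
    d*mass≡d*1 = trans hm (sym (ℚP.*-identityʳ D))
    lhs : fromℕ (2 ℕ.* N2 ℕ.+ L ℕ.* L ℕ.* d) ≡ D ℚ.* ((𝔼 normSq μ ℚ.+ 𝔼 normSq μ) ℚ.+ ℓ ℚ.* ℓ)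
    lhs = begin
        fromℕ (2 ℕ.* N2 ℕ.+ L ℕ.* L ℕ.* d)
      ≡⟨ trans (fromℕ-+ (2 ℕ.* N2) (L ℕ.* L ℕ.* d)) (cong₂ ℚ._+_ (fromℕ-* 2 N2) (trans (fromℕ-* (L ℕ.* L) d) (cong (ℚ._* D) (fromℕ-* L L)))) ⟩
        two ℚ.* fromℕ N2 ℚ.+ ℓ ℚ.* ℓ ℚ.* D
      ≡⟨ cong (λ z → two ℚ.* z ℚ.+ ℓ ℚ.* ℓ ℚ.* D) (sym h2) ⟩
        two ℚ.* (D ℚ.* 𝔼 normSq μ) ℚ.+ ℓ ℚ.* ℓ ℚ.* D
      ≡⟨ solve 3 (λ D e l → con two :* (D :* e) :+ l :* l :* D := D :* ((e :+ e) :+ l :* l)) refl D (𝔼 normSq μ) ℓ ⟩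
        D ℚ.* ((𝔼 normSq μ ℚ.+ 𝔼 normSq μ) ℚ.+ ℓ ℚ.* ℓ)
      ∎
    rhs : fromℕ (2 ℕ.* L ℕ.* (Nx ℕ.+ Ny) ℕ.+ 2 ℕ.* L ℕ.* d) ≡ D ℚ.* ((ℓ ℚ.+ ℓ) ℚ.* (meanX μ ℚ.+ meanY μ) ℚ.+ (ℓ ℚ.+ ℓ))
    rhs = begin
        fromℕ (2 ℕ.* L ℕ.* (Nx ℕ.+ Ny) ℕ.+ 2 ℕ.* L ℕ.* d)
      ≡⟨ trans (fromℕ-+ (2 ℕ.* L ℕ.* (Nx ℕ.+ Ny)) (2 ℕ.* L ℕ.* d))
               (cong₂ ℚ._+_ (trans (fromℕ-* (2 ℕ.* L) (Nx ℕ.+ Ny)) (cong₂ ℚ._*_ (fromℕ-* 2 L) (fromℕ-+ Nx Ny)))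
                            (trans (fromℕ-* (2 ℕ.* L) d) (cong (ℚ._* D) (fromℕ-* 2 L)))) ⟩
        two ℚ.* ℓ ℚ.* (fromℕ Nx ℚ.+ fromℕ Ny) ℚ.+ two ℚ.* ℓ ℚ.* D
      ≡⟨ cong₂ (λ u v → two ℚ.* ℓ ℚ.* (u ℚ.+ v) ℚ.+ two ℚ.* ℓ ℚ.* D) (sym hx) (sym hy) ⟩
        two ℚ.* ℓ ℚ.* (D ℚ.* meanX μ ℚ.+ D ℚ.* meanY μ) ℚ.+ two ℚ.* ℓ ℚ.* D
      ≡⟨ solve 4 (λ l D a b → con two :* l :* (D :* a :+ D :* b) :+ con two :* l :* D := D :* ((l :+ l) :* (a :+ b) :+ (l :+ l)))
           refl ℓ D (meanX μ) (meanY μ) ⟩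
        D ℚ.* ((ℓ ℚ.+ ℓ) ℚ.* (meanX μ ℚ.+ meanY μ) ℚ.+ (ℓ ℚ.+ ℓ))
      ∎

  record VarianceBound (μ : Law) (L : ℕ) : Set where
    field
      nonNeg    : NonNeg μ
      mass≡1    : mass μ ≡ 1ℚ
      variance≤ : variance μ ℚ.≤ fromℕ L

  trivLaw-bound : ∀ L → VarianceBound (trivLaw L) L
  trivLaw-bound L = record
    { nonNeg    = tabulate-nonNeg (2 ^ L) (L C_) diagonal (upTo (suc L))
    ; mass≡1    = proj₁ bounds
    ; variance≤ = proj₂ bounds
    }
    where
    instance
      2^L≢0 : ℕ.NonZero (2 ^ L)
      2^L≢0 = ℕ.>-nonZero (ℕP.m^n>0 2 L)
    diagonal : ℕ → Pt
    diagonal x = (+ x , + x)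
    B₁ B₂ : ℕ
    B₁ = binomialSum L (λ x → x)
    B₂ = binomialSum L (λ x → x ℕ.* x)
    moment : ∀ f h → (∀ x → f (diagonal x) ≡ fromℕ (h x)) → fromℕ (2 ^ L) ℚ.* 𝔼 f (trivLaw L) ≡ fromℕ (binomialSum L h)
    moment f h f≡h = 𝔼-tabulate (2 ^ L) (L C_) diagonal f h f≡h id (suc L)
    inequality : 2 ℕ.* binomialSum L (λ x → x ℕ.* x ℕ.+ x ℕ.* x) ℕ.+ L ℕ.* L ℕ.* 2 ^ L ℕ.≤ 2 ℕ.* L ℕ.* (B₁ ℕ.+ B₁) ℕ.+ 2 ℕ.* L ℕ.* 2 ^ L
    inequality rewrite binomialSum-+ L (λ x → x ℕ.* x) (λ x → x ℕ.* x) =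
      trivial-moment-inequality L (2 ^ L) B₁ B₂ (binomialSum-id L) (binomialSum-square L)
    bounds : mass (trivLaw L) ≡ 1ℚ × variance (trivLaw L) ℚ.≤ fromℕ L
    bounds = moments⇒variance≤ (trivLaw L) L (2 ^ L) B₁ B₁ (binomialSum L (λ x → x ℕ.* x ℕ.+ x ℕ.* x))
      (trans (moment (λ _ → 1ℚ) (λ _ → 1) (λ _ → refl)) (cong fromℕ (binomialSum-1 L)))
      (moment X (λ x → x) (λ _ → refl)) (moment Y (λ x → x) (λ _ → refl)) (moment normSq (λ x → x ℕ.* x ℕ.+ x ℕ.* x) (λ x → normSq-fromℕ x x))
      inequality

  ntntLaw-bound : ∀ m → VarianceBound (ntntLaw (suc m)) (suc m)
  ntntLaw-bound m = record
    { nonNeg    = concatMap-nonNeg row (λ x → tabulate-nonNeg A (weight m x) (point x) (upTo (2 ℕ.+ m))) (upTo (2 ℕ.+ m))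
    ; mass≡1    = proj₁ bounds
    ; variance≤ = proj₂ bounds
    }
    where
    A : ℕ
    A = 2 ^ suc m ∸ 1
    instance
      A≢0 : ℕ.NonZero A
      A≢0 = ℕ.>-nonZero (2^suc∸1>0 m)
    point : ℕ → ℕ → Pt
    point x y = (+ x , + y)
    row : ℕ → Law
    row x = map (λ y → ((+ weight m x y) / A , point x y)) (upTo (2 ℕ.+ m))
    moment : ∀ f h → (∀ x y → f (point x y) ≡ fromℕ (h x y)) → fromℕ A ℚ.* 𝔼 f (ntntLaw (suc m)) ≡ fromℕ (ntntSum m h)
    moment f h f≡h = 𝔼-concatMap A f row (λ x → ntntRow m x h)
      (λ x → 𝔼-tabulate A (weight m x) (point x) f (h x) (f≡h x) id (2 ℕ.+ m)) id (2 ℕ.+ m)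
    q : ℕ
    q = ℕ.pred (2 ^ m)
    2^m≡1+q : 2 ^ m ≡ suc q
    2^m≡1+q = sym (ℕP.suc-pred (2 ^ m) {{ℕ.>-nonZero (ℕP.m^n>0 2 m)}})
    total≡A : ntntSum m (λ _ _ → 1) ≡ A
    total≡A = sym (trans (cong (_∸ 1) (sym (ntntSum-1 m))) (ℕP.m+n∸n≡m (ntntSum m (λ _ _ → 1)) 1))
    A≡1+2q : A ≡ 1 ℕ.+ 2 ℕ.* q
    A≡1+2q = ℕP.+-cancelʳ-≡ 1 A (1 ℕ.+ 2 ℕ.* q)
      (trans (cong (ℕ._+ 1) (sym total≡A)) (trans (ntntSum-1 m) (trans (cong (2 ℕ.*_) 2^m≡1+q) (trans (ℕP.*-distribˡ-+ 2 1 q) (ℕP.+-comm 1 (1 ℕ.+ 2 ℕ.* q))))))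
    Sx Sy Sxx Syy : ℕ
    Sx = ntntSum m (λ x _ → x)
    Sy = ntntSum m (λ _ y → y)
    Sxx = ntntSum m (λ x _ → x ℕ.* x)
    Syy = ntntSum m (λ _ y → y ℕ.* y)
    inequality : 2 ℕ.* ntntSum m (λ x y → x ℕ.* x ℕ.+ y ℕ.* y) ℕ.+ suc m ℕ.* suc m ℕ.* A ℕ.≤ 2 ℕ.* suc m ℕ.* (Sx ℕ.+ Sy) ℕ.+ 2 ℕ.* suc m ℕ.* A
    inequality rewrite ntntSum-+ m (λ x _ → x ℕ.* x) (λ _ y → y ℕ.* y) =
      ntnt-moment-inequality (suc m) q A Sx Sy Sxx Syy A≡1+2q
        (trans (ntntSum-x m) (cong (suc m ℕ.*_) 2^m≡1+q)) (trans (ntntSum-y m) (cong (suc m ℕ.*_) 2^m≡1+q))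
        (trans (ntntSum-xx m) (cong (suc m ℕ.* suc (suc m) ℕ.*_) 2^m≡1+q)) (trans (ntntSum-yy m) (cong (suc m ℕ.* suc (suc m) ℕ.*_) 2^m≡1+q))
    bounds : mass (ntntLaw (suc m)) ≡ 1ℚ × variance (ntntLaw (suc m)) ℚ.≤ fromℕ (suc m)
    bounds = moments⇒variance≤ (ntntLaw (suc m)) (suc m) A Sx Sy (ntntSum m (λ x y → x ℕ.* x ℕ.+ y ℕ.* y))
      (trans (moment (λ _ → 1ℚ) (λ _ _ → 1) (λ _ _ → refl)) (cong fromℕ total≡A))
      (moment X (λ x _ → x) (λ _ _ → refl)) (moment Y (λ _ y → y) (λ _ _ → refl))
      (moment normSq (λ x y → x ℕ.* x ℕ.+ y ℕ.* y) normSq-fromℕ) inequality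

  swapAtom : ℚ × Pt → ℚ × Pt
  swapAtom a = (proj₁ a , swapPt (proj₂ a))

  𝔼-swap : ∀ f μ → 𝔼 f (map swapAtom μ) ≡ 𝔼 (λ v → f (swapPt v)) μ
  𝔼-swap f [] = refl
  𝔼-swap f (a ∷ μ) = cong (proj₁ a ℚ.* f (swapPt (proj₂ a)) ℚ.+_) (𝔼-swap f μ)

  swap-bound : ∀ {μ L} → VarianceBound μ L → VarianceBound (map swapAtom μ) L
  swap-bound {μ} {L} b = record
    { nonNeg    = swap-nonNeg nonNeg
    ; mass≡1    = trans (𝔼-swap (λ _ → 1ℚ) μ) mass≡1
    ; variance≤ = subst (ℚ._≤ fromℕ L) (sym variance-swap) variance≤
    }
    where
    open VarianceBound b
    swap-nonNeg : ∀ {μ} → NonNeg μ → NonNeg (map swapAtom μ)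
    swap-nonNeg [] = []
    swap-nonNeg (p⁺ ∷ μ⁺) = p⁺ ∷ swap-nonNeg μ⁺
    variance-swap : variance (map swapAtom μ) ≡ variance μ
    variance-swap
      rewrite 𝔼-swap X μ | 𝔼-swap Y μ | 𝔼-swap normSq μ
            | 𝔼-cong (λ { (a , b) → ℚP.+-comm (fromℤ b ℚ.* fromℤ b) (fromℤ a ℚ.* fromℤ a) }) μ =
      solve 3 (λ e x y → e :- y :* y :- x :* x := e :- x :* x :- y :* y) refl (𝔼 normSq μ) (meanX μ) (meanY μ)

  lawOf-bound : ∀ b → Admissible b → VarianceBound (lawOf (proj₂ b) (proj₁ b)) (proj₁ b)
  lawOf-bound (L , triv) _ = trivLaw-bound L
  lawOf-bound (suc m , ntnt) _ = ntntLaw-bound m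
  lawOf-bound (suc m , ntntSwap) _ = swap-bound (ntntLaw-bound m)

  sumLaw-bound : ∀ bs → All Admissible bs → VarianceBound (sumLaw bs) (sumL bs)
  sumLaw-bound [] [] = record
    { nonNeg    = ℚP.nonNegative⁻¹ 1ℚ ∷ []
    ; mass≡1    = refl
    ; variance≤ = ℚP.≤-refl
    }
  sumLaw-bound (b ∷ bs) (b-adm ∷ bs-adm) = record
    { nonNeg    = indepSum-nonNeg B.nonNeg S.nonNeg
    ; mass≡1    = trans (mass-indepSum μ ν) (cong₂ ℚ._*_ S.mass≡1 B.mass≡1)
    ; variance≤ = subst₂ ℚ._≤_ (sym (variance-indepSum μ ν B.mass≡1 S.mass≡1)) (sym (fromℕ-+ (proj₁ b) (sumL bs)))
                         (ℚP.+-mono-≤ B.variance≤ S.variance≤)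
    }
    where
    μ ν : Law
    μ = lawOf (proj₂ b) (proj₁ b)
    ν = sumLaw bs
    module B = VarianceBound (lawOf-bound b b-adm)
    module S = VarianceBound (sumLaw-bound bs bs-adm)

open import Data.Nat using (ℕ; _≤_)
open import Data.Integer using (+_)
open import Data.Rational using (ℚ; ½; _/_)
open import Data.List using (List)
open import Data.List.Relation.Unary.All using (All)
open import Data.Product using (_×_)
open Casts using (fromℕ; fromℕ-pos; fromℕ-mono-≤; fromℕ-+)
open Chebyshev using (chebyshev-½)
open Blocks using (VarianceBound; sumLaw-bound)
import Data.Nat.Properties as ℕP
import Data.Rational.Properties as ℚP
open import Relation.Binary.PropositionalEquality

lemma8 : (n : ℕ) → 1 ≤ n → (bs : List (ℕ × Kind)) → All Admissible bs → sumL bs ≤ n →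
    ½ Data.Rational.≤ discProb ((+ (2 Data.Nat.* n)) / 1) (sumLaw bs)
lemma8 n 1≤n bs admissible sumL≤n =
  subst (λ r → ½ Data.Rational.≤ discProb r (sumLaw bs)) (sym 2n≡n+n)
    (chebyshev-½ (fromℕ n) (sumLaw bs) (fromℕ-pos n {{Data.Nat.>-nonZero 1≤n}}) nonNeg mass≡1
       (ℚP.≤-trans variance≤ (fromℕ-mono-≤ sumL≤n)))
  where
  open VarianceBound (sumLaw-bound bs admissible)
  2n≡n+n : fromℕ (2 Data.Nat.* n) ≡ fromℕ n Data.Rational.+ fromℕ n
  2n≡n+n = trans (cong fromℕ (cong (n Data.Nat.+_) (ℕP.+-identityʳ n))) (fromℕ-+ n n)
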